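{- Let $\Sigma$ be a monoidal signature. The canonical trace of $\mathrm{Csp}_D(\mathbf{Hyp}_\Sigma)$ restricts to a trace on $\mathsf{PLM}\,\mathrm{Csp}_D(\mathbf{Hyp}_\Sigma)$: for every partial left-monogamous cospan $x+m\xrightarrow{[f,h]}K\xleftarrow{[g,k]}x+n$, its canonical trace $\mathrm{Tr}^x$ (a cospan $m\to K'\leftarrow n$) is again partial left-monogamous.
   Context: A monoidal signature $\Sigma$ is a set of generators each with an arity and coarity in $\mathbb{N}$. A hypergraph $F$ has a set $F_\star$ of vertices and sets $F_{k,l}$ of hyperedges with ordered source maps $s_i$ ($i<k$) and target maps $t_j$ ($j<l$) into $F_\star$; $\mathbf{Hyp}_\Sigma$ is the category of hypergraphs whose hyperedges in $F_{k,l}$ are labelled by generators of arity $k$ and coarity $l$, with structure-preserving morphisms. The discrete hypergraph $n$ has $n$ vertices and no hyperedges. $\mathrm{Csp}_D(\mathbf{Hyp}_\Sigma)$ is the PROP whose morphisms $m\to n$ are isomorphism classes of cospans $m\to F\leftarrow n$ in $\mathbf{Hyp}_\Sigma$, composition by pushout, tensor by disjoint union. It carries a Frobenius structure given by discrete cospans merge $n+n\to n\leftarrow n$, unit $0\to n\leftarrow n$, copy $n\to n\leftarrow n+n$, counit $n\to n\leftarrow 0$; with $\mathrm{cup}_x=$ unit;copy and $\mathrm{cap}_x=$ merge;counit, the canonical trace of $h:x+m\to x+n$ is $(\mathrm{cup}_x\otimes\mathrm{id}_m);(\mathrm{id}_x\otimes h);(\mathrm{cap}_x\otimes\mathrm{id}_n)$;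 concretely, for $x+m\xrightarrow{[f,h]}K\xleftarrow{[g,k]}x+n$ it is $m\to K'\leftarrow n$ where $K'$ is the quotient of $K$ identifying $f(a)$ with $g(a)$ for all $a\in x$. The in-degree of a vertex $v$ is the number of pairs $(e,j)$ with $v=t_j(e)$. A cospan $m\xrightarrow{f}F\xleftarrow{g}n$ is partial left-monogamous if $f$ is injective and every vertex in the image of $f$ has in-degree $0$ while every other vertex has in-degree $0$ or $1$ (out-degrees, i.e. numbers of pairs $(e,i)$ with $v=s_i(e)$, are arbitrary). $\mathsf{PLM}\,\mathrm{Csp}_D(\mathbf{Hyp}_\Sigma)$ is the sub-PROP of partial left-monogamous cospans. -}

module Defs where

open import Level using (Level; _⊔_) renaming (suc to lsuc)
open import Data.Nat using (ℕ; _+_)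
open import Data.Fin using (Fin; _↑ˡ_; _↑ʳ_)
open import Data.Product using (Σ; _,_; _×_)
open import Data.Empty using (⊥)
open import Relation.Binary.PropositionalEquality using (_≡_)

record Signature : Set₁ where
  field
    Gen   : Set
    arity   : Gen → ℕ
    coarity : Gen → ℕ
open Signature public

record Hyp (Σg : Signature) : Set₁ where
  field
    Vtx  : Set
    Edge : Set
    label : Edge → Gen Σg
    src  : (e : Edge) → Fin (arity Σg (label e)) → Vtx
    tgt  : (e : Edge) → Fin (coarity Σg (label e)) → Vtx
open Hyp public

TgtPos : {Σg : Signature} → Hyp Σg → Set
TgtPos {Σg} F = Σ (Edge F) (λ e → Fin (coarity Σg (label F e)))

tgtOf : {Σg : Signature} (F : Hyp Σg) → TgtPos F → Vtx F
tgtOf F (e , j) = tgt F e j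

-- A cospan m → F ← n in Hyp_Σ (the discrete hypergraph n has vertex set Fin n).
record Cospan (Σg : Signature) (m n : ℕ) : Set₁ where
  field
    apex : Hyp Σg
    left  : Fin m → Vtx apex
    right : Fin n → Vtx apex
open Cospan public

-- Partial left-monogamy, stated for the apex taken modulo an equivalence
-- relation _≈_ on its vertices (vertices of the quotient = ≈-classes).
-- With _≈_ = _≡_ this is literally the paper's definition:
--  * f injective;
--  * a vertex in the image of f has in-degree 0 (no (e,j) with t_j(e) = v);
--  * every vertex has in-degree ≤ 1 (any two (e,j),(e',j') targeting v coincide).
record PLMmod {Σg : Signature} {m n : ℕ} (c : Cospan Σg m n)
              (_≈_ : Vtx (apex c) → Vtx (apex c) → Set) : Set where
  field
    injective : ∀ a b → left c a ≈ left c b → a ≡ b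
    inDeg0    : ∀ a (p : TgtPos (apex c)) → tgtOf (apex c) p ≈ left c a → ⊥
    inDeg≤1   : ∀ v (p q : TgtPos (apex c)) →
                tgtOf (apex c) p ≈ v → tgtOf (apex c) q ≈ v → p ≡ q

PLM : {Σg : Signature} {m n : ℕ} → Cospan Σg m n → Set
PLM c = PLMmod c _≡_

data TraceRel {Σg : Signature} (x m n : ℕ) (c : Cospan Σg (x + m) (x + n))
     : Vtx (apex c) → Vtx (apex c) → Set where
  glue  : ∀ (a : Fin x) → TraceRel x m n c (left c (a ↑ˡ m)) (right c (a ↑ˡ n))
  ≈refl  : ∀ {u} → TraceRel x m n c u u
  ≈sym   : ∀ {u v} → TraceRel x m n c u v → TraceRel x m n c v u
  ≈trans : ∀ {u v w} → TraceRel x m n c u v → TraceRel x m n c v w → TraceRel x m n c u w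

-- The canonical trace Tr^x(c) : m → K' ← n, where K' = K / TraceRel.
-- Its apex has the same vertices and hyperedges as K, with vertex equality
-- given by TraceRel (i.e. the quotient presented as a setoid); its legs are
-- h = b ↦ [f,h](x + b) and k = c ↦ [g,k](x + c).
traceCospan : {Σg : Signature} (x m n : ℕ) → Cospan Σg (x + m) (x + n) → Cospan Σg m n
traceCospan x m n c = record
  { apex  = apex c
  ; left  = λ b → left c (x ↑ʳ b)
  ; right = λ d → right c (x ↑ʳ d)
  }

-- The trace is partial left-monogamous when it is so as a cospan whose apex
-- is the quotient K' (vertex equality = TraceRel).
PLMTrace : {Σg : Signature} (x m n : ℕ) → Cospan Σg (x + m) (x + n) → Set
PLMTrace x m n c = PLMmod (traceCospan x m n c) (TraceRel x m n c)

-- Read the gluing performed by Tr^x as a rewriting step f(a) ⟶ g(a), a ∈ x.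
-- Injectivity of f makes this step deterministic, hence confluent, so two
-- vertices identified by the trace that are both in normal form are already
-- equal in K.  Targets of hyperedges are in normal form because f-images have
-- in-degree 0, and the legs f(x + b) of the trace are by injectivity of f; so
-- each condition of partial left-monogamy for Tr^x reduces to the same
-- condition for the original cospan.
module Submission where

open import Defs
open import Data.Nat using (ℕ; _+_)
open import Data.Fin using (Fin; _↑ˡ_; _↑ʳ_; splitAt)
open import Data.Fin.Properties using (↑ˡ-injective; ↑ʳ-injective; splitAt-↑ˡ; splitAt-↑ʳ)
open import Data.Product using (∃; _,_; _×_)
open import Level using (0ℓ)
open import Relation.Binary.Core using (Rel; _⇒_)
open import Relation.Binary.Construct.Closure.Equivalence using (EqClosure; symmetric; transitive; return)
open import Relation.Binary.Construct.Closure.ReflexiveTransitive using (ε)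
open import Relation.Binary.Rewriting using (Deterministic; IsNormalForm; det⇒conf; conf⇒unf)
open import Relation.Binary.PropositionalEquality using (_≡_; _≢_; refl; sym; trans; cong)

↑ˡ≢↑ʳ : ∀ {x m} (a : Fin x) (b : Fin m) → a ↑ˡ m ≢ x ↑ʳ b
↑ˡ≢↑ʳ {x} {m} a b eq with trans (sym (splitAt-↑ˡ x a m)) (trans (cong (splitAt x) eq) (splitAt-↑ʳ x m b))
... | ()

module _ {Σg : Signature} {x m n : ℕ} (c : Cospan Σg (x + m) (x + n)) where

  _⟶_ : Rel (Vtx (apex c)) 0ℓ
  u ⟶ v = ∃ λ a → u ≡ left c (a ↑ˡ m) × v ≡ right c (a ↑ˡ n)

  TraceRel⇒EqClosure : TraceRel x m n c ⇒ EqClosure _⟶_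
  TraceRel⇒EqClosure (glue a)     = return (a , refl , refl)
  TraceRel⇒EqClosure ≈refl        = ε
  TraceRel⇒EqClosure (≈sym r)     = symmetric _⟶_ (TraceRel⇒EqClosure r)
  TraceRel⇒EqClosure (≈trans r s) = transitive _⟶_ (TraceRel⇒EqClosure r) (TraceRel⇒EqClosure s)

  module _ (left-injective : ∀ a b → left c a ≡ left c b → a ≡ b) where

    ⟶-deterministic : Deterministic _≡_ _⟶_
    ⟶-deterministic (a , u≡fa , refl) (a′ , u≡fa′ , refl)
      with ↑ˡ-injective m a a′ (left-injective _ _ (trans (sym u≡fa) u≡fa′))
    ... | refl = refl

    TraceRel-normal⇒≡ : ∀ {u v} → IsNormalForm _⟶_ u → IsNormalForm _⟶_ v →
                        TraceRel x m n c u v → u ≡ v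
    TraceRel-normal⇒≡ u-nf v-nf r =
      conf⇒unf (det⇒conf ⟶-deterministic) u-nf v-nf (TraceRel⇒EqClosure r)

    traceLeft-normal : ∀ b → IsNormalForm _⟶_ (left c (x ↑ʳ b))
    traceLeft-normal b (_ , a , fxb≡fa , _) = ↑ˡ≢↑ʳ a b (sym (left-injective _ _ fxb≡fa))

  tgt-normal : (∀ a (p : TgtPos (apex c)) → tgtOf (apex c) p ≢ left c a) →
               ∀ p → IsNormalForm _⟶_ (tgtOf (apex c) p)
  tgt-normal inDeg0 p (_ , a , t≡fa , _) = inDeg0 (a ↑ˡ m) p t≡fa

proposition4p9 : (Σg : Signature) (x m n : ℕ) (c : Cospan Σg (x + m) (x + n)) →
    PLM c → PLMTrace x m n c
proposition4p9 Σg x m n c P = record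
  { injective = λ a b r → ↑ʳ-injective x a b (injective _ _ (≈⇒≡ (leftNF a) (leftNF b) r))
  ; inDeg0    = λ a p r → inDeg0 (x ↑ʳ a) p (≈⇒≡ (tgtNF p) (leftNF a) r)
  ; inDeg≤1   = λ v p q r s → inDeg≤1 _ p q (≈⇒≡ (tgtNF p) (tgtNF q) (≈trans r (≈sym s))) refl
  }
  where
    open PLMmod P

    ≈⇒≡ : ∀ {u v} → IsNormalForm (_⟶_ c) u → IsNormalForm (_⟶_ c) v →
          TraceRel x m n c u v → u ≡ v
    ≈⇒≡ = TraceRel-normal⇒≡ c injective

    leftNF : ∀ b → IsNormalForm (_⟶_ c) (left c (x ↑ʳ b))
    leftNF = traceLeft-normal c injective

    tgtNF : ∀ p → IsNormalForm (_⟶_ c) (tgtOf (apex c) p)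
    tgtNF = tgt-normal c inDeg0
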